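{- Let $m_1,n_1,m_2,n_2,m_3$ be positive integers and let $\Psi$ be the graph whose vertex set is the disjoint union of sets $A_1,B_1,A_2,B_2,A_3$ with $|A_i|=m_i$, $|B_i|=n_i$, where each $A_i$ is an independent set, each $B_i$ is a clique, consecutive sets in the order $A_1,B_1,A_2,B_2,A_3$ are completely joined, and there are no other edges. Let $\mathbf d$ assign the value $2$ to every vertex of $A_1\cup A_2\cup A_3$ and $1$ to every vertex of $B_1\cup B_2$. Then the Smith normal form of $D_X(\Psi)|_{X=\mathbf d}$ is $\operatorname{diag}(1,1,2,2,0,\dots,0)$, and $\Psi\in\Lambda_2^{\mathbb Z}$.
   Context: All graphs are finite, simple, connected. For a connected graph $G$ with vertex set $V$, let $X=\{x_u:u\in V\}$ be indeterminates, $D(G)$ the distance matrix (entries $d_G(u,v)$), and $D_X(G)=\operatorname{diag}(X)+D(G)$; $D_X(G)|_{X=\mathbf d}$ is the integer matrix obtained by substituting $x_u=d_u$. The Smith normal form of an integer matrix of rank $r$ is the unique diagonal matrix $\operatorname{diag}(f_1,\dots,f_r,0,\dots,0)$ equivalent to it over $\mathbb Z$ with $f_i>0$, $f_i\mid f_{i+1}$. For a commutative ring $\mathfrak R$ with unity, the $i$-th distance ideal $I_i^{\mathfrak R}(G)$ is the ideal of $\mathfrak R[X]$ generated by all $i\times i$ minors of $D_X(G)$; an ideal is trivial if it equals $\mathfrak R[X]$; $\Lambda_k^{\mathfrak R}$ is the family of connected graphs with at most $k$ trivial distance ideals over $\mathfrak R[X]$. -}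

module Defs where

open import Data.Nat as ℕ using (ℕ; zero; suc; _+_; _≤_; _<ᵇ_)
open import Data.Integer as ℤ using (ℤ; +_; -[1+_])
open import Data.Fin as Fin using (Fin; toℕ; punchIn)
open import Data.Bool using (Bool; true; false; _∧_; _∨_; not; if_then_else_)
open import Data.List using (List; []; _∷_; length)
open import Data.List.Relation.Unary.All using (All)
open import Data.List.Relation.Unary.Unique.Propositional using (Unique)
open import Data.Empty using (⊥)
open import Data.Product using (Σ; _×_; _,_; proj₁)
open import Relation.Binary.PropositionalEquality using (_≡_)
open import Relation.Nullary using (does)

sumFin : ∀ {n} → (Fin n → ℤ) → ℤ
sumFin {zero}  f = + 0
sumFin {suc n} f = f Fin.zero ℤ.+ sumFin (λ i → f (Fin.suc i))

Mat : ℕ → Set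
Mat n = Fin n → Fin n → ℤ

_⊠_ : ∀ {n} → Mat n → Mat n → Mat n
(A ⊠ B) i j = sumFin (λ k → A i k ℤ.* B k j)

idMat : ∀ {n} → Mat n
idMat i j = if does (i Fin.≟ j) then + 1 else + 0

_≐_ : ∀ {n} → Mat n → Mat n → Set
A ≐ B = ∀ i j → A i j ≡ B i j

Unimodular : ∀ {n} → Mat n → Set
Unimodular {n} P = Σ (Mat n) λ P' → ((P ⊠ P') ≐ idMat) × ((P' ⊠ P) ≐ idMat)

EquivZ : ∀ {n} → Mat n → Mat n → Set
EquivZ {n} M S = Σ (Mat n) λ P → Σ (Mat n) λ Q →
  Unimodular P × Unimodular Q × (((P ⊠ M) ⊠ Q) ≐ S)

diag1122 : ∀ {n} → Mat n
diag1122 i j with does (i Fin.≟ j) | toℕ i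
... | true | 0 = + 1
... | true | 1 = + 1
... | true | 2 = + 2
... | true | 3 = + 2
... | _    | _ = + 0

-- Since the Smith normal form is unique, "the SNF of M is diag(1,1,2,2,0..0)"
-- means that diag(1,1,2,2,0,…,0) (which is in Smith form) is ℤ-equivalent to M.
SNFis1122 : ∀ {n} → Mat n → Set
SNFis1122 M = EquivZ M diag1122

Adj : ℕ → Set
Adj n = Fin n → Fin n → Bool

anyFin : ∀ {n} → (Fin n → Bool) → Bool
anyFin {zero}  f = false
anyFin {suc n} f = f Fin.zero ∨ anyFin (λ i → f (Fin.suc i))

reach : ∀ {n} → Adj n → ℕ → Fin n → Fin n → Bool
reach G zero    u v = does (u Fin.≟ v)
reach G (suc k) u v = reach G k u v ∨ anyFin (λ w → reach G k u w ∧ G w v)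

Connected : ∀ {n} → Adj n → Set
Connected {n} G = ∀ u v → reach G n u v ≡ true

leastReach : ∀ {n} → Adj n → Fin n → Fin n → ℕ → ℕ → ℕ
leastReach G u v zero    k = k
leastReach G u v (suc f) k = if reach G k u v then k else leastReach G u v f (suc k)

-- graph distance (correct for connected graphs: d(u,v) ≤ n - 1)
dist : ∀ {n} → Adj n → Fin n → Fin n → ℕ
dist {n} G u v = leastReach G u v n 0

-- Polynomials ℤ[X], X = {x_u : u ∈ Fin n}: polynomial expressions,
-- identified when they agree as functions ℤ^n → ℤ (ℤ is an infinite
-- integral domain, so this quotient is exactly ℤ[X]).

data Poly (n : ℕ) : Set where
  con  : ℤ → Poly n
  var  : Fin n → Poly n
  _⊕_  : Poly n → Poly n → Poly n
  _⊗_  : Poly n → Poly n → Poly n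

eval : ∀ {n} → (Fin n → ℤ) → Poly n → ℤ
eval ρ (con c) = c
eval ρ (var x) = ρ x
eval ρ (p ⊕ q) = eval ρ p ℤ.+ eval ρ q
eval ρ (p ⊗ q) = eval ρ p ℤ.* eval ρ q

_≈P_ : ∀ {n} → Poly n → Poly n → Set
p ≈P q = ∀ ρ → eval ρ p ≡ eval ρ q

sumP : ∀ {n k} → (Fin k → Poly n) → Poly n
sumP {k = zero}  f = con (+ 0)
sumP {k = suc k} f = f Fin.zero ⊕ sumP (λ i → f (Fin.suc i))

sign : ∀ {n} → ℕ → Poly n
sign zero          = con (+ 1)
sign (suc zero)    = con -[1+ 0 ]
sign (suc (suc k)) = sign k

det : ∀ {n k} → (Fin k → Fin k → Poly n) → Poly n
det {k = zero}  M = con (+ 1)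
det {k = suc k} M =
  sumP (λ j → (sign (toℕ j) ⊗ M Fin.zero j)
               ⊗ det (λ a b → M (Fin.suc a) (punchIn j b)))

DX : ∀ {n} → Adj n → Fin n → Fin n → Poly n
DX G u v = if does (u Fin.≟ v) then var u ⊕ con (+ dist G u v)
                               else con (+ dist G u v)

DXat : ∀ {n} → Adj n → (Fin n → ℤ) → Mat n
DXat G d u v = eval d (DX G u v)

-- strictly increasing maps Fin i → Fin n (row / column selections)
IncMap : ℕ → ℕ → Set
IncMap i n = Σ (Fin i → Fin n) λ f → ∀ a b → a Fin.< b → f a Fin.< f b

minor : ∀ {n i} → Adj n → IncMap i n → IncMap i n → Poly n
minor G (r , _) (c , _) = det (λ a b → DX G (r a) (c b))

sumList : ∀ {n} → List (Poly n) → Poly n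
sumList []       = con (+ 0)
sumList (p ∷ ps) = p ⊕ sumList ps

termsOf : ∀ {n i} → Adj n → List (IncMap i n × IncMap i n × Poly n) → List (Poly n)
termsOf G []                  = []
termsOf G ((r , c , h) ∷ ts)  = (h ⊗ minor G r c) ∷ termsOf G ts

InDistIdeal : ∀ {n} → Adj n → ℕ → Poly n → Set
InDistIdeal {n} G i p =
  Σ (List (IncMap i n × IncMap i n × Poly n)) λ ts → sumList (termsOf G ts) ≈P p

TrivialIdeal : ∀ {n} → Adj n → ℕ → Set
TrivialIdeal G i = InDistIdeal G i (con (+ 1))

-- G ∈ Λ_k^ℤ : G is connected and has at most k trivial distance ideals
-- (among I_1, …, I_n): no k+1 distinct indices carry trivial ideals.
InLambda : ∀ {n} → ℕ → Adj n → Set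
InLambda {n} k G = Connected G ×
  ((is : List ℕ) → length is ≡ suc k → Unique is →
     All (λ i → 1 ≤ i × i ≤ n) is → All (TrivialIdeal G) is → ⊥)

data Part : Set where
  A₁ B₁ A₂ B₂ A₃ : Part

PsiSize : ℕ → ℕ → ℕ → ℕ → ℕ → ℕ
PsiSize m₁ n₁ m₂ n₂ m₃ = m₁ + n₁ + m₂ + n₂ + m₃

partOf : (m₁ n₁ m₂ n₂ m₃ : ℕ) → Fin (PsiSize m₁ n₁ m₂ n₂ m₃) → Part
partOf m₁ n₁ m₂ n₂ m₃ v =
  if toℕ v <ᵇ m₁ then A₁ else
  if toℕ v <ᵇ m₁ + n₁ then B₁ else
  if toℕ v <ᵇ m₁ + n₁ + m₂ then A₂ else
  if toℕ v <ᵇ m₁ + n₁ + m₂ + n₂ then B₂ else A₃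

partAdj : Part → Part → Bool
partAdj B₁ B₁ = true
partAdj B₂ B₂ = true
partAdj A₁ B₁ = true
partAdj B₁ A₁ = true
partAdj B₁ A₂ = true
partAdj A₂ B₁ = true
partAdj A₂ B₂ = true
partAdj B₂ A₂ = true
partAdj B₂ A₃ = true
partAdj A₃ B₂ = true
partAdj _  _  = false

Psi : (m₁ n₁ m₂ n₂ m₃ : ℕ) → Adj (PsiSize m₁ n₁ m₂ n₂ m₃)
Psi m₁ n₁ m₂ n₂ m₃ u v =
  not (does (u Fin.≟ v)) ∧ partAdj (partOf m₁ n₁ m₂ n₂ m₃ u) (partOf m₁ n₁ m₂ n₂ m₃ v)

partWeight : Part → ℤ
partWeight B₁ = + 1
partWeight B₂ = + 1
partWeight _  = + 2

dPsi : (m₁ n₁ m₂ n₂ m₃ : ℕ) → Fin (PsiSize m₁ n₁ m₂ n₂ m₃) → ℤ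
dPsi m₁ n₁ m₂ n₂ m₃ v = partWeight (partOf m₁ n₁ m₂ n₂ m₃ v)

{-# OPTIONS --safe #-}
module Submission where

-- Evaluated at 𝐝, the entry of D_X(Ψ) at (u, v) depends only on the parts of u and v: for
-- different parts it is their distance along the path A₁ B₁ A₂ B₂ A₃, and on the diagonal 𝐝
-- puts exactly the distance between two twins (1 inside a clique B, 2 inside an independent
-- set A). So twins have equal rows and columns; subtracting one from the other deletes a twin
-- up to ℤ-equivalence, and the matrix reduces to the 5 × 5 matrix of part distances padded
-- with zeros, whose Smith form diag(1,1,2,2,0) is certified by explicit unimodular matrices.
-- Modulo 2 the part-distance matrix has rank 2, so every minor of D_X(Ψ) of order at least 3
-- is even at 𝐝. Every element of I₃, I₄, … is then even at 𝐝, so none of them contains 1,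
-- and Ψ has at most the two trivial ideals I₁, I₂.

open import Defs
open import Data.Bool.Base using (Bool; true; false; T; not; _∧_; if_then_else_)
open import Data.Bool.Properties using (T-∨; T-∧; T-≡)
open import Data.Sum.Base using (_⊎_; inj₁; inj₂)
open import Function.Bundles using (Equivalence)
open import Data.Fin as Fin using (Fin; zero; suc; toℕ; fromℕ<; punchIn; punchOut)
open import Data.Fin.Patterns using (0F; 1F; 2F; 3F; 4F)
open import Data.Fin.Permutation as Perm using (Permutation; Permutation′; _⟨$⟩ʳ_; _⟨$⟩ˡ_; inverseˡ; inverseʳ)
open import Data.Fin.Properties using (punchIn-punchOut; all?; any?; ¬Fin0; injective⇒≤; toℕ-fromℕ<)
open import Data.Integer.Base as ℤ using (ℤ; +_; -1ℤ; _+_; _*_; _-_; -_)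
import Data.Integer.Properties as ℤ
import Data.Nat.Properties as ℕ
import Data.Nat.Divisibility as ℕ using (∣1⇒≡1)
open import Data.List.Base using (List; []; _∷_; length)
open import Data.List.Relation.Unary.All using (All; []; _∷_)
open import Data.List.Relation.Unary.AllPairs using ([]; _∷_)
open import Data.List.Relation.Unary.Unique.Propositional using (Unique)
open import Data.Empty using (⊥)
open import Data.Integer.Divisibility.Signed using (_∣_; _∣?_; divides; ∣⇒∣ᵤ; ∣m∣n⇒∣m+n; ∣n⇒∣m*n; ∣m⇒∣m*n)
open import Data.Integer.Tactic.RingSolver using (solve-∀)
open import Data.Nat as ℕ using (ℕ; zero; suc; _≤_; z≤n; s≤s; _<ᵇ_)
open import Data.Product.Base using (Σ; ∃; ∃₂; _×_; _,_; proj₁; proj₂)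
open import Data.Vec.Base using (Vec; []; _∷_; lookup)
import Data.Vec.Functional as Vector
open import Function.Base using (_∘_)
open import Level using (0ℓ)
open import Relation.Binary.Bundles using (Setoid)
open import Relation.Binary.PropositionalEquality
import Relation.Binary.Reasoning.Setoid
open import Relation.Nullary.Decidable using (Dec; yes; no; does; from-yes; dec-true; dec-false; map′; T?; ¬?; _×-dec_; _→-dec_)
open import Relation.Nullary.Negation using (¬_; contradiction)

sumFin-cong : ∀ {n} {f g : Fin n → ℤ} → (∀ i → f i ≡ g i) → sumFin f ≡ sumFin g
sumFin-cong {zero}  f≗g = refl
sumFin-cong {suc n} f≗g = cong₂ _+_ (f≗g zero) (sumFin-cong (f≗g ∘ suc))

sumFin-zero : ∀ {n} {f : Fin n → ℤ} → (∀ i → f i ≡ + 0) → sumFin f ≡ + 0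
sumFin-zero {zero}  f≗0 = refl
sumFin-zero {suc n} f≗0 = cong₂ _+_ (f≗0 zero) (sumFin-zero (f≗0 ∘ suc))

sumFin-+ : ∀ {n} (f g : Fin n → ℤ) → sumFin (λ i → f i + g i) ≡ sumFin f + sumFin g
sumFin-+ {zero}  f g = refl
sumFin-+ {suc n} f g =
  trans (cong (_+_ (f zero + g zero)) (sumFin-+ (f ∘ suc) (g ∘ suc)))
        (interchange (f zero) (g zero) (sumFin (f ∘ suc)) (sumFin (g ∘ suc)))
  where
  interchange : ∀ a b c d → (a + b) + (c + d) ≡ (a + c) + (b + d)
  interchange = solve-∀

*-distribˡ-sumFin : ∀ {n} x (f : Fin n → ℤ) → x * sumFin f ≡ sumFin (λ i → x * f i)
*-distribˡ-sumFin {zero}  x f = ℤ.*-zeroʳ x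
*-distribˡ-sumFin {suc n} x f =
  trans (ℤ.*-distribˡ-+ x (f zero) _) (cong (_+_ (x * f zero)) (*-distribˡ-sumFin x (f ∘ suc)))

*-distribʳ-sumFin : ∀ {n} x (f : Fin n → ℤ) → sumFin f * x ≡ sumFin (λ i → f i * x)
*-distribʳ-sumFin {zero}  x f = refl
*-distribʳ-sumFin {suc n} x f =
  trans (ℤ.*-distribʳ-+ x (f zero) _) (cong (_+_ (f zero * x)) (*-distribʳ-sumFin x (f ∘ suc)))

sumFin-comm : ∀ {m n} (f : Fin m → Fin n → ℤ) →
  sumFin (λ i → sumFin (f i)) ≡ sumFin (λ j → sumFin (λ i → f i j))
sumFin-comm {zero} {n} f = sym (sumFin-zero {n} (λ _ → refl))
sumFin-comm {suc m} f =
  trans (cong (_+_ (sumFin (f zero))) (sumFin-comm (f ∘ suc)))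
        (sym (sumFin-+ (f zero) (λ j → sumFin (λ i → f (suc i) j))))

idMat-sym : ∀ {n} (i j : Fin n) → idMat i j ≡ idMat j i
idMat-sym zero    zero    = refl
idMat-sym zero    (suc j) = refl
idMat-sym (suc i) zero    = refl
idMat-sym (suc i) (suc j) = idMat-sym i j

sumFin-δˡ : ∀ {n} (i : Fin n) (f : Fin n → ℤ) → sumFin (λ k → idMat i k * f k) ≡ f i
sumFin-δˡ {suc n} zero f =
  trans (cong₂ _+_ (ℤ.*-identityˡ (f zero)) (sumFin-zero {n} (λ _ → refl))) (ℤ.+-identityʳ (f zero))
sumFin-δˡ (suc i) f = trans (ℤ.+-identityˡ _) (sumFin-δˡ i (f ∘ suc))

sumFin-δʳ : ∀ {n} (i : Fin n) (f : Fin n → ℤ) → sumFin (λ k → f k * idMat k i) ≡ f i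
sumFin-δʳ i f = trans (sumFin-cong (λ k → trans (ℤ.*-comm (f k) _) (cong (_* f k) (idMat-sym k i))))
                      (sumFin-δˡ i f)

≐-setoid : ℕ → Setoid 0ℓ 0ℓ
≐-setoid n = record
  { Carrier       = Mat n
  ; _≈_           = _≐_
  ; isEquivalence = record
    { refl  = λ _ _ → refl
    ; sym   = λ A≐B i j → sym (A≐B i j)
    ; trans = λ A≐B B≐C i j → trans (A≐B i j) (B≐C i j)
    }
  }

module ≐-Reasoning {n} = Relation.Binary.Reasoning.Setoid (≐-setoid n)

infix 30 _ᵀ

_ᵀ : ∀ {n} → Mat n → Mat n
(A ᵀ) i j = A j i

⊠-cong : ∀ {n} {A A′ B B′ : Mat n} → A ≐ A′ → B ≐ B′ → (A ⊠ B) ≐ (A′ ⊠ B′)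
⊠-cong A≐A′ B≐B′ i j = sumFin-cong (λ k → cong₂ _*_ (A≐A′ i k) (B≐B′ k j))

⊠-congˡ : ∀ {n} {A A′ : Mat n} (B : Mat n) → A ≐ A′ → (A ⊠ B) ≐ (A′ ⊠ B)
⊠-congˡ B A≐A′ = ⊠-cong A≐A′ (λ _ _ → refl)

⊠-congʳ : ∀ {n} (A : Mat n) {B B′ : Mat n} → B ≐ B′ → (A ⊠ B) ≐ (A ⊠ B′)
⊠-congʳ A = ⊠-cong {A = A} (λ _ _ → refl)

⊠-assoc : ∀ {n} (A B C : Mat n) → ((A ⊠ B) ⊠ C) ≐ (A ⊠ (B ⊠ C))
⊠-assoc A B C i j = begin
  sumFin (λ k → sumFin (λ l → A i l * B l k) * C k j)
    ≡⟨ sumFin-cong (λ k → *-distribʳ-sumFin (C k j) (λ l → A i l * B l k)) ⟩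
  sumFin (λ k → sumFin (λ l → A i l * B l k * C k j))
    ≡⟨ sumFin-comm (λ k l → A i l * B l k * C k j) ⟩
  sumFin (λ l → sumFin (λ k → A i l * B l k * C k j))
    ≡⟨ sumFin-cong (λ l → sumFin-cong (λ k → ℤ.*-assoc (A i l) (B l k) (C k j))) ⟩
  sumFin (λ l → sumFin (λ k → A i l * (B l k * C k j)))
    ≡⟨ sumFin-cong (λ l → *-distribˡ-sumFin (A i l) (λ k → B l k * C k j)) ⟨
  sumFin (λ l → A i l * sumFin (λ k → B l k * C k j)) ∎
  where open ≡-Reasoning

⊠-identityˡ : ∀ {n} (A : Mat n) → (idMat ⊠ A) ≐ A
⊠-identityˡ A i j = sumFin-δˡ i (λ k → A k j)

⊠-ᵀ : ∀ {n} (A B : Mat n) → ((A ⊠ B) ᵀ) ≐ (B ᵀ ⊠ A ᵀ)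
⊠-ᵀ A B i j = sumFin-cong (λ k → ℤ.*-comm (A j k) (B k i))

idMatᵀ : ∀ {n} → (idMat ᵀ) ≐ idMat {n}
idMatᵀ i j = idMat-sym j i

fromRows : ∀ {n} → Vec (Vec ℤ n) n → Mat n
fromRows rows i j = lookup (lookup rows i) j

infix 4 _≐?_

_≐?_ : ∀ {n} (A B : Mat n) → Dec (A ≐ B)
A ≐? B = all? λ i → all? λ j → A i j ℤ.≟ B i j

inverse-⊠ : ∀ {n} {P P′ Q Q′ : Mat n} → (P ⊠ P′) ≐ idMat → (Q ⊠ Q′) ≐ idMat →
  ((P ⊠ Q) ⊠ (Q′ ⊠ P′)) ≐ idMat
inverse-⊠ {P = P} {P′} {Q} {Q′} PP′≐I QQ′≐I = begin
  (P ⊠ Q) ⊠ (Q′ ⊠ P′)  ≈⟨ ⊠-assoc P Q (Q′ ⊠ P′) ⟩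
  P ⊠ (Q ⊠ (Q′ ⊠ P′))  ≈⟨ ⊠-congʳ P (⊠-assoc Q Q′ P′) ⟨
  P ⊠ ((Q ⊠ Q′) ⊠ P′)  ≈⟨ ⊠-congʳ P (⊠-congˡ P′ QQ′≐I) ⟩
  P ⊠ (idMat ⊠ P′)     ≈⟨ ⊠-congʳ P (⊠-identityˡ P′) ⟩
  P ⊠ P′               ≈⟨ PP′≐I ⟩
  idMat                ∎
  where open ≐-Reasoning

Unimodular-⊠ : ∀ {n} {P Q : Mat n} → Unimodular P → Unimodular Q → Unimodular (P ⊠ Q)
Unimodular-⊠ {P = P} {Q} (P′ , PP′≐I , P′P≐I) (Q′ , QQ′≐I , Q′Q≐I) =
  Q′ ⊠ P′ , inverse-⊠ {P = P} {P′} PP′≐I QQ′≐I , inverse-⊠ {P = Q′} {Q} Q′Q≐I P′P≐I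

Unimodular-ᵀ : ∀ {n} {P : Mat n} → Unimodular P → Unimodular (P ᵀ)
Unimodular-ᵀ {P = P} (P′ , PP′≐I , P′P≐I) = P′ ᵀ , transposed {P′} {P} P′P≐I , transposed {P} {P′} PP′≐I
  where
  transposed : ∀ {A B} → (A ⊠ B) ≐ idMat → (B ᵀ ⊠ A ᵀ) ≐ idMat
  transposed {A} {B} AB≐I i j = trans (sym (⊠-ᵀ A B i j)) (trans (AB≐I j i) (idMatᵀ i j))

EquivZ-trans : ∀ {n} {M S T : Mat n} → EquivZ M S → EquivZ S T → EquivZ M T
EquivZ-trans {M = M} {S} {T} (P₁ , Q₁ , P₁-unimod , Q₁-unimod , P₁MQ₁≐S)
                             (P₂ , Q₂ , P₂-unimod , Q₂-unimod , P₂SQ₂≐T) =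
  P₂ ⊠ P₁ , Q₁ ⊠ Q₂ , Unimodular-⊠ P₂-unimod P₁-unimod , Unimodular-⊠ Q₁-unimod Q₂-unimod , equation
  where
  open ≐-Reasoning
  equation : (((P₂ ⊠ P₁) ⊠ M) ⊠ (Q₁ ⊠ Q₂)) ≐ T
  equation = begin
    ((P₂ ⊠ P₁) ⊠ M) ⊠ (Q₁ ⊠ Q₂)  ≈⟨ ⊠-congˡ (Q₁ ⊠ Q₂) (⊠-assoc P₂ P₁ M) ⟩
    (P₂ ⊠ (P₁ ⊠ M)) ⊠ (Q₁ ⊠ Q₂)  ≈⟨ ⊠-assoc (P₂ ⊠ (P₁ ⊠ M)) Q₁ Q₂ ⟨
    ((P₂ ⊠ (P₁ ⊠ M)) ⊠ Q₁) ⊠ Q₂  ≈⟨ ⊠-congˡ Q₂ (⊠-assoc P₂ (P₁ ⊠ M) Q₁) ⟩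
    (P₂ ⊠ ((P₁ ⊠ M) ⊠ Q₁)) ⊠ Q₂  ≈⟨ ⊠-congˡ Q₂ (⊠-congʳ P₂ P₁MQ₁≐S) ⟩
    (P₂ ⊠ S) ⊠ Q₂                ≈⟨ P₂SQ₂≐T ⟩
    T                            ∎

EquivZ-respˡ : ∀ {n} {M M′ S : Mat n} → M ≐ M′ → EquivZ M′ S → EquivZ M S
EquivZ-respˡ M≐M′ (P , Q , P-unimod , Q-unimod , PM′Q≐S) =
  P , Q , P-unimod , Q-unimod , λ i j → trans (⊠-congˡ Q (⊠-congʳ P M≐M′) i j) (PM′Q≐S i j)

EquivZ-respʳ : ∀ {n} {M S S′ : Mat n} → EquivZ M S → S ≐ S′ → EquivZ M S′
EquivZ-respʳ (P , Q , P-unimod , Q-unimod , PMQ≐S) S≐S′ =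
  P , Q , P-unimod , Q-unimod , λ i j → trans (PMQ≐S i j) (S≐S′ i j)

blockDiag : ∀ {n} → ℤ → Mat n → Mat (suc n)
blockDiag a X zero    zero    = a
blockDiag a X zero    (suc j) = + 0
blockDiag a X (suc i) zero    = + 0
blockDiag a X (suc i) (suc j) = X i j

blockDiag-cong : ∀ {n} {a b} {X Y : Mat n} → a ≡ b → X ≐ Y → blockDiag a X ≐ blockDiag b Y
blockDiag-cong a≡b X≐Y zero    zero    = a≡b
blockDiag-cong a≡b X≐Y zero    (suc j) = refl
blockDiag-cong a≡b X≐Y (suc i) zero    = refl
blockDiag-cong a≡b X≐Y (suc i) (suc j) = X≐Y i j

blockDiag-⊠ : ∀ {n} a b (X Y : Mat n) → (blockDiag a X ⊠ blockDiag b Y) ≐ blockDiag (a * b) (X ⊠ Y)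
blockDiag-⊠ {n} a b X Y zero zero =
  trans (cong (_+_ (a * b)) (sumFin-zero {n} (λ _ → refl))) (ℤ.+-identityʳ (a * b))
blockDiag-⊠ {n} a b X Y zero    (suc j) = cong₂ _+_ (ℤ.*-zeroʳ a) (sumFin-zero {n} (λ _ → refl))
blockDiag-⊠ {n} a b X Y (suc i) zero    =
  trans (ℤ.+-identityˡ _) (sumFin-zero (λ k → ℤ.*-zeroʳ (X i k)))
blockDiag-⊠ {n} a b X Y (suc i) (suc j) = ℤ.+-identityˡ _

blockDiag-idMat : ∀ {n} → blockDiag (+ 1) (idMat {n}) ≐ idMat
blockDiag-idMat zero    zero    = refl
blockDiag-idMat zero    (suc j) = refl
blockDiag-idMat (suc i) zero    = refl
blockDiag-idMat (suc i) (suc j) = refl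

Unimodular-blockDiag : ∀ {n} {P : Mat n} → Unimodular P → Unimodular (blockDiag (+ 1) P)
Unimodular-blockDiag {P = P} (P′ , PP′≐I , P′P≐I) =
  blockDiag (+ 1) P′ , inverse PP′≐I , inverse P′P≐I
  where
  inverse : ∀ {A B} → (A ⊠ B) ≐ idMat → (blockDiag (+ 1) A ⊠ blockDiag (+ 1) B) ≐ idMat
  inverse {A} {B} AB≐I i j =
    trans (blockDiag-⊠ (+ 1) (+ 1) A B i j) (trans (blockDiag-cong refl AB≐I i j) (blockDiag-idMat i j))

EquivZ-blockDiag : ∀ {n} a {M S : Mat n} → EquivZ M S → EquivZ (blockDiag a M) (blockDiag a S)
EquivZ-blockDiag a {M} {S} (P , Q , P-unimod , Q-unimod , PMQ≐S) =
  blockDiag (+ 1) P , blockDiag (+ 1) Q , Unimodular-blockDiag P-unimod , Unimodular-blockDiag Q-unimod , equation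
  where
  open ≐-Reasoning
  equation : ((blockDiag (+ 1) P ⊠ blockDiag a M) ⊠ blockDiag (+ 1) Q) ≐ blockDiag a S
  equation = begin
    (blockDiag (+ 1) P ⊠ blockDiag a M) ⊠ blockDiag (+ 1) Q
      ≈⟨ ⊠-congˡ (blockDiag (+ 1) Q) (blockDiag-⊠ (+ 1) a P M) ⟩
    blockDiag (+ 1 * a) (P ⊠ M) ⊠ blockDiag (+ 1) Q
      ≈⟨ blockDiag-⊠ (+ 1 * a) (+ 1) (P ⊠ M) Q ⟩
    blockDiag (+ 1 * a * + 1) ((P ⊠ M) ⊠ Q)
      ≈⟨ blockDiag-cong (trans (ℤ.*-identityʳ (+ 1 * a)) (ℤ.*-identityˡ a)) PMQ≐S ⟩
    blockDiag a S ∎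

-- Deleting twin rows and columns

permMat : ∀ {n} → Permutation′ n → Mat n
permMat σ i k = idMat (σ ⟨$⟩ʳ i) k

permMat-⊠ : ∀ {n} (σ : Permutation′ n) (X : Mat n) i j → (permMat σ ⊠ X) i j ≡ X (σ ⟨$⟩ʳ i) j
permMat-⊠ σ X i j = sumFin-δˡ (σ ⟨$⟩ʳ i) (λ k → X k j)

⊠-permMatᵀ : ∀ {n} (σ : Permutation′ n) (X : Mat n) i j → (X ⊠ permMat σ ᵀ) i j ≡ X i (σ ⟨$⟩ʳ j)
⊠-permMatᵀ σ X i j =
  trans (sumFin-cong (λ k → cong (_*_ (X i k)) (idMat-sym (σ ⟨$⟩ʳ j) k))) (sumFin-δʳ (σ ⟨$⟩ʳ j) (X i))

Unimodular-permMat : ∀ {n} (σ : Permutation′ n) → Unimodular (permMat σ)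
Unimodular-permMat σ = permMat (Perm.flip σ) ,
  (λ i j → trans (permMat-⊠ σ (permMat (Perm.flip σ)) i j) (cong (λ k → idMat k j) (inverseˡ σ))) ,
  (λ i j → trans (permMat-⊠ (Perm.flip σ) (permMat σ) i j) (cong (λ k → idMat k j) (inverseʳ σ)))

EquivZ-permute : ∀ {n} (σ : Permutation′ n) (M : Mat n) →
  EquivZ M (λ i j → M (σ ⟨$⟩ʳ i) (σ ⟨$⟩ʳ j))
EquivZ-permute σ M = permMat σ , permMat σ ᵀ ,
  Unimodular-permMat σ , Unimodular-ᵀ (Unimodular-permMat σ) ,
  λ i j → trans (⊠-permMatᵀ σ (permMat σ ⊠ M) i j) (permMat-⊠ σ M i (σ ⟨$⟩ʳ j))

rowAdd : ∀ {n} → Fin n → ℤ → Mat (suc n)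
rowAdd t c zero    zero    = + 1
rowAdd t c zero    (suc k) = c * idMat t k
rowAdd t c (suc i) k       = idMat (suc i) k

rowAdd-⊠-zero : ∀ {n} (t : Fin n) c (X : Mat (suc n)) j →
  (rowAdd t c ⊠ X) zero j ≡ X zero j + c * X (suc t) j
rowAdd-⊠-zero t c X j = cong₂ _+_ (ℤ.*-identityˡ (X zero j)) (begin
  sumFin (λ k → c * idMat t k * X (suc k) j)    ≡⟨ sumFin-cong (λ k → ℤ.*-assoc c (idMat t k) (X (suc k) j)) ⟩
  sumFin (λ k → c * (idMat t k * X (suc k) j))  ≡⟨ *-distribˡ-sumFin c (λ k → idMat t k * X (suc k) j) ⟨
  c * sumFin (λ k → idMat t k * X (suc k) j)    ≡⟨ cong (_*_ c) (sumFin-δˡ t (λ k → X (suc k) j)) ⟩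
  c * X (suc t) j                               ∎)
  where open ≡-Reasoning

rowAdd-⊠-suc : ∀ {n} (t : Fin n) c (X : Mat (suc n)) i j → (rowAdd t c ⊠ X) (suc i) j ≡ X (suc i) j
rowAdd-⊠-suc t c X i j = sumFin-δˡ (suc i) (λ k → X k j)

rowAdd-inverse : ∀ {n} (t : Fin n) {a b} → b + a ≡ + 0 → (rowAdd t a ⊠ rowAdd t b) ≐ idMat
rowAdd-inverse t {a} {b} b+a≡0 zero zero =
  trans (rowAdd-⊠-zero t a (rowAdd t b) zero) (cong (_+_ (+ 1)) (ℤ.*-zeroʳ a))
rowAdd-inverse t {a} {b} b+a≡0 zero (suc k) = begin
  (rowAdd t a ⊠ rowAdd t b) zero (suc k)  ≡⟨ rowAdd-⊠-zero t a (rowAdd t b) (suc k) ⟩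
  b * idMat t k + a * idMat t k           ≡⟨ ℤ.*-distribʳ-+ (idMat t k) b a ⟨
  (b + a) * idMat t k                     ≡⟨ cong (_* idMat t k) b+a≡0 ⟩
  + 0 * idMat t k                         ≡⟨ ℤ.*-zeroˡ (idMat t k) ⟩
  + 0                                     ∎
  where open ≡-Reasoning
rowAdd-inverse t {a} {b} b+a≡0 (suc i) j = rowAdd-⊠-suc t a (rowAdd t b) i j

Unimodular-rowAdd : ∀ {n} (t : Fin n) c → Unimodular (rowAdd t c)
Unimodular-rowAdd t c =
  rowAdd t (- c) , rowAdd-inverse t (ℤ.+-inverseˡ c) , rowAdd-inverse t (ℤ.+-inverseʳ c)

EquivZ-deleteTwin₀ : ∀ {n} (t : Fin n) (M : Mat (suc n)) →
  (∀ j → M zero j ≡ M (suc t) j) → (∀ i → M i zero ≡ M i (suc t)) →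
  EquivZ M (blockDiag (+ 0) (λ i j → M (suc i) (suc j)))
EquivZ-deleteTwin₀ {n} t M row≡ col≡ =
  E , E ᵀ , Unimodular-rowAdd t -1ℤ , Unimodular-ᵀ {P = E} (Unimodular-rowAdd t -1ℤ) , equation
  where
  E : Mat (suc n)
  E = rowAdd t -1ℤ

  cancel : ∀ {x y} → x ≡ y → x + -1ℤ * y ≡ + 0
  cancel {x} refl = trans (cong (_+_ x) (ℤ.-1*i≡-i x)) (ℤ.+-inverseʳ x)

  ⊠Eᵀ-zero : ∀ (Y : Mat (suc n)) i → (Y ⊠ E ᵀ) i zero ≡ Y i zero + -1ℤ * Y i (suc t)
  ⊠Eᵀ-zero Y i = trans (sym (⊠-ᵀ E (Y ᵀ) i zero)) (rowAdd-⊠-zero t -1ℤ (Y ᵀ) i)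

  ⊠Eᵀ-suc : ∀ (Y : Mat (suc n)) i j → (Y ⊠ E ᵀ) i (suc j) ≡ Y i (suc j)
  ⊠Eᵀ-suc Y i j = trans (sym (⊠-ᵀ E (Y ᵀ) i (suc j))) (rowAdd-⊠-suc t -1ℤ (Y ᵀ) j i)

  EM-zero : ∀ j → (E ⊠ M) zero j ≡ + 0
  EM-zero j = trans (rowAdd-⊠-zero t -1ℤ M j) (cancel (row≡ j))

  EM-suc : ∀ i j → (E ⊠ M) (suc i) j ≡ M (suc i) j
  EM-suc = rowAdd-⊠-suc t -1ℤ M

  equation : ((E ⊠ M) ⊠ E ᵀ) ≐ blockDiag (+ 0) (λ i j → M (suc i) (suc j))
  equation zero    zero    = trans (⊠Eᵀ-zero (E ⊠ M) zero) (cancel (trans (EM-zero zero) (sym (EM-zero (suc t)))))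
  equation zero    (suc j) = trans (⊠Eᵀ-suc (E ⊠ M) zero j) (EM-zero (suc j))
  equation (suc i) zero    = trans (⊠Eᵀ-zero (E ⊠ M) (suc i))
    (cancel (trans (EM-suc i zero) (trans (col≡ (suc i)) (sym (EM-suc i (suc t))))))
  equation (suc i) (suc j) = trans (⊠Eᵀ-suc (E ⊠ M) (suc i) j) (EM-suc i (suc j))

-- toFront v sends 0 to v and suc k to punchIn v k, both definitionally.
toFront : ∀ {n} → Fin (suc n) → Permutation′ (suc n)
toFront v = Perm.flip (Perm.insert v zero Perm.id)

EquivZ-deleteTwin : ∀ {n} (M : Mat (suc n)) {v w : Fin (suc n)} → v ≢ w →
  (∀ j → M v j ≡ M w j) → (∀ i → M i v ≡ M i w) →
  EquivZ M (blockDiag (+ 0) (λ i j → M (punchIn v i) (punchIn v j)))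
EquivZ-deleteTwin {n} M {v} {w} v≢w row≡ col≡ =
  EquivZ-trans {M = M} (EquivZ-permute (toFront v) M)
                       (EquivZ-deleteTwin₀ (punchOut v≢w) (λ i j → M (σ i) (σ j)) row≡′ col≡′)
  where
  σ : Fin (suc n) → Fin (suc n)
  σ = toFront v ⟨$⟩ʳ_
  row≡′ : ∀ j → M v (σ j) ≡ M (punchIn v (punchOut v≢w)) (σ j)
  row≡′ j = trans (row≡ (σ j)) (cong (λ x → M x (σ j)) (sym (punchIn-punchOut v≢w)))
  col≡′ : ∀ i → M (σ i) v ≡ M (σ i) (punchIn v (punchOut v≢w))
  col≡′ i = trans (col≡ (σ i)) (cong (M (σ i)) (sym (punchIn-punchOut v≢w)))

diag : ∀ {n} → (Fin n → ℤ) → Mat n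
diag f i j = if does (i Fin.≟ j) then f i else + 0

diag-cong : ∀ {n} {f g : Fin n → ℤ} → (∀ i → f i ≡ g i) → diag f ≐ diag g
diag-cong f≗g i j = cong (λ x → if does (i Fin.≟ j) then x else + 0) (f≗g i)

diag-permute : ∀ {n} (σ : Permutation′ n) (f : Fin n → ℤ) i j →
  diag f (σ ⟨$⟩ʳ i) (σ ⟨$⟩ʳ j) ≡ diag (f ∘ (σ ⟨$⟩ʳ_)) i j
diag-permute σ f i j with i Fin.≟ j
... | yes refl = cong (λ b → if b then _ else + 0) (dec-true (σ ⟨$⟩ʳ i Fin.≟ σ ⟨$⟩ʳ i) refl)
... | no i≢j  = cong (λ b → if b then _ else + 0) (dec-false (σ ⟨$⟩ʳ i Fin.≟ σ ⟨$⟩ʳ j) (i≢j ∘ injective))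
  where
  injective : σ ⟨$⟩ʳ i ≡ σ ⟨$⟩ʳ j → i ≡ j
  injective σi≡σj = trans (sym (inverseˡ σ)) (trans (cong (σ ⟨$⟩ˡ_) σi≡σj) (inverseˡ σ))

snfEntry : ℕ → ℤ
snfEntry 0 = + 1
snfEntry 1 = + 1
snfEntry 2 = + 2
snfEntry 3 = + 2
snfEntry _ = + 0

diag1122-diag : ∀ {n} → diag1122 {n} ≐ diag (snfEntry ∘ toℕ)
diag1122-diag i j with does (i Fin.≟ j) | toℕ i
... | true  | 0                         = refl
... | true  | 1                         = refl
... | true  | 2                         = refl
... | true  | 3                         = refl
... | true  | suc (suc (suc (suc _)))   = refl
... | false | _                         = refl

blockDiag-diag : ∀ {n} (f : Fin n → ℤ) → blockDiag (+ 0) (diag f) ≐ diag (+ 0 Vector.∷ f)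
blockDiag-diag f zero    zero    = refl
blockDiag-diag f zero    (suc j) = refl
blockDiag-diag f (suc i) zero    = refl
blockDiag-diag f (suc i) (suc j) = refl

EquivZ-rotate : ∀ {n} → 4 ≤ n → EquivZ (blockDiag (+ 0) (diag1122 {n})) diag1122
EquivZ-rotate {n@(suc (suc (suc (suc k))))} (s≤s (s≤s (s≤s (s≤s z≤n)))) =
  EquivZ-respʳ {M = blockDiag (+ 0) diag1122} (EquivZ-permute ρ (blockDiag (+ 0) diag1122)) entries
  where
  -- ρ moves the zero that blockDiag puts in front to position 4.
  ρ : Permutation′ (suc n)
  ρ = Perm.insert 4F 0F Perm.id

  shifted : ∀ i → (+ 0 Vector.∷ snfEntry ∘ toℕ) (ρ ⟨$⟩ʳ i) ≡ snfEntry (toℕ i)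
  shifted 0F                              = refl
  shifted 1F                              = refl
  shifted 2F                              = refl
  shifted 3F                              = refl
  shifted 4F                              = refl
  shifted (suc (suc (suc (suc (suc _))))) = refl

  entries : ∀ i j → blockDiag (+ 0) diag1122 (ρ ⟨$⟩ʳ i) (ρ ⟨$⟩ʳ j) ≡ diag1122 i j
  entries i j = begin
    blockDiag (+ 0) diag1122 (ρ ⟨$⟩ʳ i) (ρ ⟨$⟩ʳ j)
      ≡⟨ blockDiag-cong refl diag1122-diag (ρ ⟨$⟩ʳ i) (ρ ⟨$⟩ʳ j) ⟩
    blockDiag (+ 0) (diag (snfEntry ∘ toℕ)) (ρ ⟨$⟩ʳ i) (ρ ⟨$⟩ʳ j)
      ≡⟨ blockDiag-diag (snfEntry ∘ toℕ) (ρ ⟨$⟩ʳ i) (ρ ⟨$⟩ʳ j) ⟩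
    diag (+ 0 Vector.∷ snfEntry ∘ toℕ) (ρ ⟨$⟩ʳ i) (ρ ⟨$⟩ʳ j)
      ≡⟨ diag-permute ρ (+ 0 Vector.∷ snfEntry ∘ toℕ) i j ⟩
    diag ((+ 0 Vector.∷ snfEntry ∘ toℕ) ∘ (ρ ⟨$⟩ʳ_)) i j
      ≡⟨ diag-cong shifted i j ⟩
    diag (snfEntry ∘ toℕ) i j
      ≡⟨ diag1122-diag i j ⟨
    diag1122 i j ∎
    where open ≡-Reasoning

-- Determinants modulo an integer

signℤ : ℕ → ℤ
signℤ zero          = + 1
signℤ (suc zero)    = -1ℤ
signℤ (suc (suc k)) = signℤ k

firstRowMinor : ∀ {k} → Fin (suc k) → Mat (suc k) → Mat k
firstRowMinor j m a b = m (suc a) (punchIn j b)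

detℤ : ∀ {k} → Mat k → ℤ
detℤ {zero}  m = + 1
detℤ {suc k} m = sumFin (λ j → (signℤ (toℕ j) * m zero j) * detℤ (firstRowMinor j m))

eval-sumP : ∀ {n k} ρ (f : Fin k → Poly n) → eval ρ (sumP f) ≡ sumFin (λ j → eval ρ (f j))
eval-sumP {k = zero}  ρ f = refl
eval-sumP {k = suc k} ρ f = cong (_+_ (eval ρ (f zero))) (eval-sumP ρ (f ∘ suc))

eval-sign : ∀ {n} ρ k → eval ρ (sign {n} k) ≡ signℤ k
eval-sign ρ zero          = refl
eval-sign ρ (suc zero)    = refl
eval-sign ρ (suc (suc k)) = eval-sign ρ k

eval-det : ∀ {n k} ρ (N : Fin k → Fin k → Poly n) → eval ρ (det N) ≡ detℤ (λ a b → eval ρ (N a b))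
eval-det {k = zero}  ρ N = refl
eval-det {k = suc k} ρ N =
  trans (eval-sumP ρ (λ j → (sign (toℕ j) ⊗ N zero j) ⊗ det (λ a b → N (suc a) (punchIn j b))))
        (sumFin-cong (λ j → cong₂ _*_ (cong (_* eval ρ (N zero j)) (eval-sign ρ (toℕ j)))
                                      (eval-det ρ (λ a b → N (suc a) (punchIn j b)))))

detℤ-cong : ∀ {k} {m m′ : Mat k} → m ≐ m′ → detℤ m ≡ detℤ m′
detℤ-cong {zero}  m≐m′ = refl
detℤ-cong {suc k} m≐m′ = sumFin-cong (λ j →
  cong₂ _*_ (cong (_*_ (signℤ (toℕ j))) (m≐m′ zero j)) (detℤ-cong (λ a b → m≐m′ (suc a) (punchIn j b))))

detℤ-1 : (m : Mat 1) → detℤ m ≡ m 0F 0F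
detℤ-1 m = expansion (m 0F 0F)
  where
  expansion : ∀ a → (+ 1 * a) * + 1 + + 0 ≡ a
  expansion = solve-∀

detℤ-2 : (m : Mat 2) → detℤ m ≡ m 0F 0F * m 1F 1F - m 0F 1F * m 1F 0F
detℤ-2 m = expansion {m 0F 0F} {m 0F 1F} (detℤ-1 (firstRowMinor 0F m)) (detℤ-1 (firstRowMinor 1F m))
  where
  cofactors : ∀ a b x y → (+ 1 * a) * x + ((-1ℤ * b) * y + + 0) ≡ a * x - b * y
  cofactors = solve-∀
  expansion : ∀ {a b x y x′ y′} → x ≡ x′ → y ≡ y′ →
    (+ 1 * a) * x + ((-1ℤ * b) * y + + 0) ≡ a * x′ - b * y′
  expansion {a} {b} {x} {y} refl refl = cofactors a b x y

detℤ-3 : (m : Mat 3) → detℤ m ≡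
  m 0F 0F * (m 1F 1F * m 2F 2F - m 1F 2F * m 2F 1F) -
  m 0F 1F * (m 1F 0F * m 2F 2F - m 1F 2F * m 2F 0F) +
  m 0F 2F * (m 1F 0F * m 2F 1F - m 1F 1F * m 2F 0F)
detℤ-3 m = expansion {m 0F 0F} {m 0F 1F} {m 0F 2F}
  (detℤ-2 (firstRowMinor 0F m)) (detℤ-2 (firstRowMinor 1F m)) (detℤ-2 (firstRowMinor 2F m))
  where
  cofactors : ∀ a b c x y z →
    (+ 1 * a) * x + ((-1ℤ * b) * y + ((+ 1 * c) * z + + 0)) ≡ a * x - b * y + c * z
  cofactors = solve-∀
  expansion : ∀ {a b c x y z x′ y′ z′} → x ≡ x′ → y ≡ y′ → z ≡ z′ →
    (+ 1 * a) * x + ((-1ℤ * b) * y + ((+ 1 * c) * z + + 0)) ≡ a * x′ - b * y′ + c * z′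
  expansion {a} {b} {c} {x} {y} {z} refl refl refl = cofactors a b c x y z

rank≤2-det₃ : ∀ a₀ a₁ a₂ c₀ c₁ c₂ b₀ b₁ b₂ d₀ d₁ d₂ →
  let m₀₀ = a₀ * b₀ + c₀ * d₀ ; m₀₁ = a₀ * b₁ + c₀ * d₁ ; m₀₂ = a₀ * b₂ + c₀ * d₂
      m₁₀ = a₁ * b₀ + c₁ * d₀ ; m₁₁ = a₁ * b₁ + c₁ * d₁ ; m₁₂ = a₁ * b₂ + c₁ * d₂
      m₂₀ = a₂ * b₀ + c₂ * d₀ ; m₂₁ = a₂ * b₁ + c₂ * d₁ ; m₂₂ = a₂ * b₂ + c₂ * d₂
  in m₀₀ * (m₁₁ * m₂₂ - m₁₂ * m₂₁) - m₀₁ * (m₁₀ * m₂₂ - m₁₂ * m₂₀) + m₀₂ * (m₁₀ * m₂₁ - m₁₁ * m₂₀)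
     ≡ + 0
rank≤2-det₃ = solve-∀

rank≤2-det : ∀ k (a c b d : Fin (3 ℕ.+ k) → ℤ) → detℤ (λ i j → a i * b j + c i * d j) ≡ + 0
rank≤2-det zero a c b d =
  trans (detℤ-3 (λ i j → a i * b j + c i * d j))
        (rank≤2-det₃ (a 0F) (a 1F) (a 2F) (c 0F) (c 1F) (c 2F) (b 0F) (b 1F) (b 2F) (d 0F) (d 1F) (d 2F))
rank≤2-det (suc k) a c b d = sumFin-zero λ j →
  let x = signℤ (toℕ j) * (a 0F * b j + c 0F * d j) in
  trans (cong (_*_ x) (rank≤2-det k (a ∘ suc) (c ∘ suc) (b ∘ punchIn j) (d ∘ punchIn j))) (ℤ.*-zeroʳ x)

infix 4 _≡_mod_

-- A record rather than a synonym for k ∣ x - y, so that x, y and k can be inferred.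
record _≡_mod_ (x y k : ℤ) : Set where
  constructor mod-by
  field
    divides-difference : k ∣ x - y

infix 4 _≡?_mod_

_≡?_mod_ : ∀ x y k → Dec (x ≡ y mod k)
x ≡? y mod k = map′ mod-by _≡_mod_.divides-difference (k ∣? x - y)

≡-mod-refl : ∀ {k} x → x ≡ x mod k
≡-mod-refl {k} x = mod-by (divides (+ 0) (trans (ℤ.+-inverseʳ x) (sym (ℤ.*-zeroˡ k))))

+-cong-mod : ∀ {k x y x′ y′} → x ≡ y mod k → x′ ≡ y′ mod k → x + x′ ≡ y + y′ mod k
+-cong-mod {k} {x} {y} {x′} {y′} (mod-by k∣x-y) (mod-by k∣x′-y′) =
  mod-by (subst (k ∣_) (sym (regroup x y x′ y′)) (∣m∣n⇒∣m+n k∣x-y k∣x′-y′))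
  where
  regroup : ∀ x y x′ y′ → (x + x′) - (y + y′) ≡ (x - y) + (x′ - y′)
  regroup = solve-∀

*-cong-mod : ∀ {k x y x′ y′} → x ≡ y mod k → x′ ≡ y′ mod k → x * x′ ≡ y * y′ mod k
*-cong-mod {k} {x} {y} {x′} {y′} (mod-by k∣x-y) (mod-by k∣x′-y′) =
  mod-by (subst (k ∣_) (sym (regroup x y x′ y′)) (∣m∣n⇒∣m+n (∣n⇒∣m*n x k∣x′-y′) (∣m⇒∣m*n y′ k∣x-y)))
  where
  regroup : ∀ x y x′ y′ → x * x′ - y * y′ ≡ x * (x′ - y′) + (x - y) * y′
  regroup = solve-∀

sumFin-cong-mod : ∀ {n k} {f g : Fin n → ℤ} → (∀ i → f i ≡ g i mod k) → sumFin f ≡ sumFin g mod k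
sumFin-cong-mod {zero}  f≡g = ≡-mod-refl (+ 0)
sumFin-cong-mod {suc n} f≡g = +-cong-mod (f≡g zero) (sumFin-cong-mod (f≡g ∘ suc))

detℤ-cong-mod : ∀ {k q} {m m′ : Mat k} → (∀ a b → m a b ≡ m′ a b mod q) → detℤ m ≡ detℤ m′ mod q
detℤ-cong-mod {zero}  m≡m′ = ≡-mod-refl (+ 1)
detℤ-cong-mod {suc k} m≡m′ = sumFin-cong-mod (λ j →
  *-cong-mod (*-cong-mod (≡-mod-refl (signℤ (toℕ j))) (m≡m′ zero j))
             (detℤ-cong-mod (λ a b → m≡m′ (suc a) (punchIn j b))))

≡0-mod⇒∣ : ∀ {k x} → x ≡ + 0 mod k → k ∣ x
≡0-mod⇒∣ {k} {x} (mod-by k∣x-0) = subst (k ∣_) (ℤ.+-identityʳ x) k∣x-0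

toFin : Part → Fin 5
toFin A₁ = 0F
toFin B₁ = 1F
toFin A₂ = 2F
toFin B₂ = 3F
toFin A₃ = 4F

fromFin : Fin 5 → Part
fromFin 0F = A₁
fromFin 1F = B₁
fromFin 2F = A₂
fromFin 3F = B₂
fromFin 4F = A₃

fromFin-toFin : ∀ p → fromFin (toFin p) ≡ p
fromFin-toFin A₁ = refl
fromFin-toFin B₁ = refl
fromFin-toFin A₂ = refl
fromFin-toFin B₂ = refl
fromFin-toFin A₃ = refl

toFin-fromFin : ∀ i → toFin (fromFin i) ≡ i
toFin-fromFin 0F = refl
toFin-fromFin 1F = refl
toFin-fromFin 2F = refl
toFin-fromFin 3F = refl
toFin-fromFin 4F = refl

toFin-injective : ∀ {p q} → toFin p ≡ toFin q → p ≡ q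
toFin-injective {p} {q} eq = trans (sym (fromFin-toFin p)) (trans (cong fromFin eq) (fromFin-toFin q))

infix 4 _≟ₚ_

_≟ₚ_ : (p q : Part) → Dec (p ≡ q)
p ≟ₚ q = map′ toFin-injective (cong toFin) (toFin p Fin.≟ toFin q)

all-Part? : {P : Part → Set} → (∀ p → Dec (P p)) → Dec (∀ p → P p)
all-Part? {P} P? = map′ (λ ∀P p → subst P (fromFin-toFin p) (∀P (toFin p))) (λ ∀P i → ∀P (fromFin i))
                        (all? (P? ∘ fromFin))

any-Part? : {P : Part → Set} → (∀ p → Dec (P p)) → Dec (∃ P)
any-Part? {P} P? = map′ (λ (i , Pi) → fromFin i , Pi) (λ (p , Pp) → toFin p , subst P (sym (fromFin-toFin p)) Pp)
                        (any? (P? ∘ fromFin))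

pullback : ∀ {n} → (Part → Part → ℤ) → (Fin n → Part) → Mat n
pullback C ℓ u v = C (ℓ u) (ℓ v)

-- The distance in Ψ between distinct vertices of parts p and q; for p = q it is the
-- weight 𝐝, since twins in a B are adjacent and twins in an A have a common neighbour.
partDist : Part → Part → ℕ
partDist p q = if does (p ≟ₚ q) then ℤ.∣ partWeight p ∣ else ℕ.∣ toℕ (toFin p) - toℕ (toFin q) ∣

partDist-diag : ∀ p → + partDist p p ≡ partWeight p + + 0
partDist-diag = from-yes (all-Part? λ p → + partDist p p ℤ.≟ partWeight p + + 0)

partAdj⇒partDist≡1 : ∀ p q → T (partAdj p q) → partDist p q ≡ 1
partAdj⇒partDist≡1 = from-yes (all-Part? λ p → all-Part? λ q → T? (partAdj p q) →-dec partDist p q ℕ.≟ 1)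

partDist≡1⇒partAdj : ∀ p q → partDist p q ≡ 1 → T (partAdj p q)
partDist≡1⇒partAdj = from-yes (all-Part? λ p → all-Part? λ q → partDist p q ℕ.≟ 1 →-dec T? (partAdj p q))

partDist-positive : ∀ p q → 1 ≤ partDist p q
partDist-positive = from-yes (all-Part? λ p → all-Part? λ q → 1 ℕ.≤? partDist p q)

partDist≤4 : ∀ p q → partDist p q ≤ 4
partDist≤4 = from-yes (all-Part? λ p → all-Part? λ q → partDist p q ℕ.≤? 4)

partDist-edge : ∀ p q r → T (partAdj q r) → partDist p r ≤ suc (partDist p q)
partDist-edge = from-yes (all-Part? λ p → all-Part? λ q → all-Part? λ r →
  T? (partAdj q r) →-dec partDist p r ℕ.≤? suc (partDist p q))

partDist-pred : ∀ p q → 2 ≤ partDist p q →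
  ∃ λ r → r ≢ p × r ≢ q × T (partAdj r q) × suc (partDist p r) ≡ partDist p q
partDist-pred = from-yes (all-Part? λ p → all-Part? λ q → 2 ℕ.≤? partDist p q →-dec any-Part? λ r →
  ¬? (r ≟ₚ p) ×-dec ¬? (r ≟ₚ q) ×-dec T? (partAdj r q) ×-dec suc (partDist p r) ℕ.≟ partDist p q)

notB₁ notB₂ : Part → ℤ
notB₁ p = if does (p ≟ₚ B₁) then + 0 else + 1
notB₂ p = if does (p ≟ₚ B₂) then + 0 else + 1

partDist-parity : ∀ p q → + partDist p q ≡ notB₁ p * notB₁ q + notB₂ p * notB₂ q mod + 2
partDist-parity = from-yes (all-Part? λ p → all-Part? λ q →
  + partDist p q ≡? notB₁ p * notB₁ q + notB₂ p * notB₂ q mod + 2)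

partDist-snf : EquivZ (pullback (λ p q → + partDist p q) fromFin) diag1122
partDist-snf = P , Q , (P⁻¹ , from-yes (P ⊠ P⁻¹ ≐? idMat) , from-yes (P⁻¹ ⊠ P ≐? idMat)) ,
                       (Q⁻¹ , from-yes (Q ⊠ Q⁻¹ ≐? idMat) , from-yes (Q⁻¹ ⊠ Q ≐? idMat)) ,
                       from-yes ((P ⊠ pullback (λ p q → + partDist p q) fromFin) ⊠ Q ≐? diag1122)
  where
  P P⁻¹ Q Q⁻¹ : Mat 5
  P = fromRows
    ( ( + 1 ∷ + 0 ∷ + 0 ∷ + 0 ∷ + 0 ∷ [])
    ∷ ( + 1 ∷ -1ℤ ∷ + 0 ∷ + 0 ∷ + 0 ∷ [])
    ∷ ( + 1 ∷ + 0 ∷ -1ℤ ∷ + 0 ∷ + 0 ∷ [])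
    ∷ ( -1ℤ ∷ + 1 ∷ + 2 ∷ -1ℤ ∷ + 0 ∷ [])
    ∷ ( + 1 ∷ -1ℤ ∷ -1ℤ ∷ -1ℤ ∷ + 1 ∷ []) ∷ [])
  P⁻¹ = fromRows
    ( ( + 1 ∷ + 0 ∷ + 0 ∷ + 0 ∷ + 0 ∷ [])
    ∷ ( + 1 ∷ -1ℤ ∷ + 0 ∷ + 0 ∷ + 0 ∷ [])
    ∷ ( + 1 ∷ + 0 ∷ -1ℤ ∷ + 0 ∷ + 0 ∷ [])
    ∷ ( + 2 ∷ -1ℤ ∷ - + 2 ∷ -1ℤ ∷ + 0 ∷ [])
    ∷ ( + 3 ∷ - + 2 ∷ - + 3 ∷ -1ℤ ∷ + 1 ∷ []) ∷ [])
  Q = fromRows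
    ( ( + 0 ∷ + 1 ∷ -1ℤ ∷ -1ℤ ∷ + 1 ∷ [])
    ∷ ( + 1 ∷ - + 2 ∷ -1ℤ ∷ + 0 ∷ -1ℤ ∷ [])
    ∷ ( + 0 ∷ + 0 ∷ + 0 ∷ + 1 ∷ -1ℤ ∷ [])
    ∷ ( + 0 ∷ + 0 ∷ + 1 ∷ + 0 ∷ -1ℤ ∷ [])
    ∷ ( + 0 ∷ + 0 ∷ + 0 ∷ + 0 ∷ + 1 ∷ []) ∷ [])
  Q⁻¹ = fromRows
    ( ( + 2 ∷ + 1 ∷ + 2 ∷ + 3 ∷ + 4 ∷ [])
    ∷ ( + 1 ∷ + 0 ∷ + 1 ∷ + 1 ∷ + 1 ∷ [])
    ∷ ( + 0 ∷ + 0 ∷ + 0 ∷ + 1 ∷ + 1 ∷ [])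
    ∷ ( + 0 ∷ + 0 ∷ + 1 ∷ + 0 ∷ + 1 ∷ [])
    ∷ ( + 0 ∷ + 0 ∷ + 0 ∷ + 0 ∷ + 1 ∷ []) ∷ [])

-- Blow-ups of the parts

Onto : ∀ {n} → (Fin n → Part) → Set
Onto {n} ℓ = ∀ p → ∃ λ (u : Fin n) → ℓ u ≡ p

Twins : ∀ {n} → (Fin n → Part) → Set
Twins ℓ = ∃₂ λ u v → u ≢ v × ℓ u ≡ ℓ v

twins? : ∀ {n} (ℓ : Fin n → Part) → Dec (Twins ℓ)
twins? ℓ = any? λ u → any? λ v → ¬? (u Fin.≟ v) ×-dec ℓ u ≟ₚ ℓ v

noTwins⇒injective : ∀ {n} {ℓ : Fin n → Part} → ¬ Twins ℓ → ∀ {u v} → ℓ u ≡ ℓ v → u ≡ v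
noTwins⇒injective ¬twins {u} {v} ℓu≡ℓv with u Fin.≟ v
... | yes u≡v = u≡v
... | no  u≢v = contradiction (u , v , u≢v , ℓu≡ℓv) ¬twins

Onto⇒5≤n : ∀ {n} {ℓ : Fin n → Part} → Onto ℓ → 5 ≤ n
Onto⇒5≤n {ℓ = ℓ} onto = injective⇒≤ injective
  where
  injective : ∀ {i j} → proj₁ (onto (fromFin i)) ≡ proj₁ (onto (fromFin j)) → i ≡ j
  injective {i} {j} eq = begin
    i                                         ≡⟨ toFin-fromFin i ⟨
    toFin (fromFin i)                         ≡⟨ cong toFin (proj₂ (onto (fromFin i))) ⟨
    toFin (ℓ (proj₁ (onto (fromFin i))))      ≡⟨ cong (toFin ∘ ℓ) eq ⟩
    toFin (ℓ (proj₁ (onto (fromFin j))))      ≡⟨ cong toFin (proj₂ (onto (fromFin j))) ⟩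
    toFin (fromFin j)                         ≡⟨ toFin-fromFin j ⟩
    j                                         ∎
    where open ≡-Reasoning

Onto-deleteTwin : ∀ {n} {ℓ : Fin (suc n) → Part} → Onto ℓ → ∀ {v w} → v ≢ w → ℓ v ≡ ℓ w →
  Onto (ℓ ∘ punchIn v)
Onto-deleteTwin {ℓ = ℓ} onto {v} {w} v≢w ℓv≡ℓw p with onto p
... | u , ℓu≡p with v Fin.≟ u
...   | yes refl = punchOut v≢w , trans (cong ℓ (punchIn-punchOut v≢w)) (trans (sym ℓv≡ℓw) ℓu≡p)
...   | no  v≢u  = punchOut v≢u , trans (cong ℓ (punchIn-punchOut v≢u)) ℓu≡p

noTwins⇒permutation : ∀ {n} {ℓ : Fin n → Part} → Onto ℓ → ¬ Twins ℓ →
  Σ (Permutation n 5) λ σ → ∀ u → fromFin (σ ⟨$⟩ʳ u) ≡ ℓ u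
noTwins⇒permutation {ℓ = ℓ} onto ¬twins =
  Perm.permutation (toFin ∘ ℓ) (proj₁ ∘ onto ∘ fromFin) toFin∘ℓ∘rep rep∘toFin∘ℓ , fromFin-toFin ∘ ℓ
  where
  toFin∘ℓ∘rep : ∀ i → toFin (ℓ (proj₁ (onto (fromFin i)))) ≡ i
  toFin∘ℓ∘rep i = trans (cong toFin (proj₂ (onto (fromFin i)))) (toFin-fromFin i)
  rep∘toFin∘ℓ : ∀ u → proj₁ (onto (fromFin (toFin (ℓ u)))) ≡ u
  rep∘toFin∘ℓ u = noTwins⇒injective ¬twins
    (trans (proj₂ (onto (fromFin (toFin (ℓ u))))) (fromFin-toFin (ℓ u)))

module _ (C : Part → Part → ℤ) (C-snf : EquivZ (pullback C fromFin) diag1122) where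

  pullback-bijective-snf : ∀ {n} (ℓ : Fin n → Part) (σ : Permutation n 5) →
    (∀ u → fromFin (σ ⟨$⟩ʳ u) ≡ ℓ u) → EquivZ (pullback C ℓ) diag1122
  pullback-bijective-snf ℓ σ σ≗ℓ with refl ← Perm.↔⇒≡ σ =
    EquivZ-trans {M = pullback C ℓ} (EquivZ-permute (Perm.flip σ) (pullback C ℓ)) (EquivZ-respˡ entries C-snf)
    where
    ℓ∘σ⁻¹ : ∀ i → ℓ (σ ⟨$⟩ˡ i) ≡ fromFin i
    ℓ∘σ⁻¹ i = trans (sym (σ≗ℓ (σ ⟨$⟩ˡ i))) (cong fromFin (inverseʳ σ))
    entries : (λ i j → pullback C ℓ (σ ⟨$⟩ˡ i) (σ ⟨$⟩ˡ j)) ≐ pullback C fromFin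
    entries i j = cong₂ C (ℓ∘σ⁻¹ i) (ℓ∘σ⁻¹ j)

  pullback-snf : ∀ {n} (ℓ : Fin n → Part) → Onto ℓ → EquivZ (pullback C ℓ) diag1122
  pullback-snf {zero}  ℓ onto = contradiction (proj₁ (onto A₁)) ¬Fin0
  pullback-snf {suc n} ℓ onto with twins? ℓ
  ... | no ¬twins =
    let σ , σ≗ℓ = noTwins⇒permutation onto ¬twins in pullback-bijective-snf ℓ σ σ≗ℓ
  ... | yes (v , w , v≢w , ℓv≡ℓw) =
    EquivZ-trans {M = pullback C ℓ} deleted (EquivZ-trans {M = blockDiag (+ 0) (pullback C ℓ′)} padded rotated)
    where
    ℓ′ : Fin n → Part
    ℓ′ = ℓ ∘ punchIn v
    onto′ : Onto ℓ′
    onto′ = Onto-deleteTwin onto v≢w ℓv≡ℓw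
    deleted : EquivZ (pullback C ℓ) (blockDiag (+ 0) (pullback C ℓ′))
    deleted = EquivZ-deleteTwin (pullback C ℓ) v≢w (λ j → cong (λ p → C p (ℓ j)) ℓv≡ℓw)
                                                   (λ i → cong (C (ℓ i)) ℓv≡ℓw)
    padded : EquivZ (blockDiag (+ 0) (pullback C ℓ′)) (blockDiag (+ 0) diag1122)
    padded = EquivZ-blockDiag (+ 0) (pullback-snf ℓ′ onto′)
    rotated : EquivZ (blockDiag (+ 0) (diag1122 {n})) diag1122
    rotated = EquivZ-rotate (ℕ.≤-trans (ℕ.n≤1+n 4) (Onto⇒5≤n onto′))

-- Graph distance from breadth-first layers

T-does⇒ : ∀ {A : Set} (a? : Dec A) → T (does a?) → A
T-does⇒ (yes a) _ = a

T-does⇐ : ∀ {A : Set} (a? : Dec A) → A → T (does a?)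
T-does⇐ (yes _) _ = _
T-does⇐ (no ¬a) a = ¬a a

T-anyFin⇒ : ∀ {n} (f : Fin n → Bool) → T (anyFin f) → ∃ λ i → T (f i)
T-anyFin⇒ {suc n} f any with Equivalence.to T-∨ any
... | inj₁ f0   = zero , f0
... | inj₂ rest = let i , fi = T-anyFin⇒ (f ∘ suc) rest in suc i , fi

T-anyFin⇐ : ∀ {n} (f : Fin n → Bool) i → T (f i) → T (anyFin f)
T-anyFin⇐ f zero    fi = Equivalence.from T-∨ (inj₁ fi)
T-anyFin⇐ f (suc i) fi = Equivalence.from T-∨ (inj₂ (T-anyFin⇐ (f ∘ suc) i fi))

module BreadthFirst {n} (G : Adj n) (δ : Fin n → Fin n → ℕ)
  (δ≡0⇒≡ : ∀ {u v} → δ u v ≡ 0 → u ≡ v)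
  (δ-refl : ∀ u → δ u u ≡ 0)
  (δ-edge : ∀ u {w v} → T (G w v) → δ u v ≤ suc (δ u w))
  (δ-pred : ∀ u v {k} → δ u v ≡ suc k → ∃ λ w → T (G w v) × δ u w ≡ k)
  where

  reach⇒δ≤ : ∀ k {u v} → T (reach G k u v) → δ u v ≤ k
  reach⇒δ≤ zero {u} {v} u≟v with refl ← T-does⇒ (u Fin.≟ v) u≟v = ℕ.≤-reflexive (δ-refl u)
  reach⇒δ≤ (suc k) {u} {v} r with Equivalence.to T-∨ r
  ... | inj₁ r-k  = ℕ.m≤n⇒m≤1+n (reach⇒δ≤ k r-k)
  ... | inj₂ r-kw =
    let w , r-k∧G = T-anyFin⇒ (λ w → reach G k u w ∧ G w v) r-kw
        r-k , Gwv = Equivalence.to T-∧ r-k∧G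
    in ℕ.≤-trans (δ-edge u Gwv) (s≤s (reach⇒δ≤ k r-k))

  δ≤⇒reach : ∀ k {u v} → δ u v ≤ k → T (reach G k u v)
  δ≤⇒reach zero {u} {v} δ≤0 = T-does⇐ (u Fin.≟ v) (δ≡0⇒≡ (ℕ.n≤0⇒n≡0 δ≤0))
  δ≤⇒reach (suc k) {u} {v} δ≤1+k with ℕ.m≤n⇒m<n∨m≡n δ≤1+k
  ... | inj₁ δ<1+k = Equivalence.from T-∨ (inj₁ (δ≤⇒reach k (ℕ.≤-pred δ<1+k)))
  ... | inj₂ δ≡1+k =
    let w , Gwv , δw≡k = δ-pred u v δ≡1+k
    in Equivalence.from T-∨ (inj₂ (T-anyFin⇐ (λ w → reach G k u w ∧ G w v) w
         (Equivalence.from T-∧ (δ≤⇒reach k (ℕ.≤-reflexive δw≡k) , Gwv))))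

  leastReach≡δ : ∀ {u v} fuel k → k ≤ δ u v → δ u v ≤ fuel ℕ.+ k → leastReach G u v fuel k ≡ δ u v
  leastReach≡δ zero k k≤δ δ≤k = ℕ.≤-antisym k≤δ δ≤k
  leastReach≡δ {u} {v} (suc fuel) k k≤δ δ≤1+fuel+k with reach G k u v in reached
  ... | true  = ℕ.≤-antisym k≤δ (reach⇒δ≤ k (subst T (sym reached) _))
  ... | false = leastReach≡δ fuel (suc k) (ℕ.≤∧≢⇒< k≤δ k≢δ) (subst (δ u v ≤_) (sym (ℕ.+-suc fuel k)) δ≤1+fuel+k)
    where
    k≢δ : k ≢ δ u v
    k≢δ k≡δ = subst T reached (δ≤⇒reach k (ℕ.≤-reflexive (sym k≡δ)))

  dist≡δ : ∀ u v → δ u v ≤ n → dist G u v ≡ δ u v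
  dist≡δ u v δ≤n = leastReach≡δ n 0 z≤n (subst (δ u v ≤_) (sym (ℕ.+-identityʳ n)) δ≤n)

  connected : (∀ u v → δ u v ≤ n) → Connected G
  connected δ≤n u v = Equivalence.to T-≡ (δ≤⇒reach n (δ≤n u v))

distinct-positive⇒≥3 : ∀ a b c → a ≢ b → a ≢ c → b ≢ c → 1 ≤ a → 1 ≤ b → 1 ≤ c →
  3 ≤ a ⊎ 3 ≤ b ⊎ 3 ≤ c
distinct-positive⇒≥3 (suc (suc (suc _))) b c _ _ _ _ _ _ = inj₁ (s≤s (s≤s (s≤s z≤n)))
distinct-positive⇒≥3 a (suc (suc (suc _))) c _ _ _ _ _ _ = inj₂ (inj₁ (s≤s (s≤s (s≤s z≤n))))
distinct-positive⇒≥3 a b (suc (suc (suc _))) _ _ _ _ _ _ = inj₂ (inj₂ (s≤s (s≤s (s≤s z≤n))))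
distinct-positive⇒≥3 1 1 c a≢b _   _   _ _ _ = contradiction refl a≢b
distinct-positive⇒≥3 2 2 c a≢b _   _   _ _ _ = contradiction refl a≢b
distinct-positive⇒≥3 1 2 1 _   a≢c _   _ _ _ = contradiction refl a≢c
distinct-positive⇒≥3 2 1 2 _   a≢c _   _ _ _ = contradiction refl a≢c
distinct-positive⇒≥3 1 2 2 _   _   b≢c _ _ _ = contradiction refl b≢c
distinct-positive⇒≥3 2 1 1 _   _   b≢c _ _ _ = contradiction refl b≢c

blowUpGraph : ∀ {n} → (Fin n → Part) → Adj n
blowUpGraph ℓ u v = not (does (u Fin.≟ v)) ∧ partAdj (ℓ u) (ℓ v)

module BlowUp {n} (ℓ : Fin n → Part) (onto : Onto ℓ) where

  G : Adj n
  G = blowUpGraph ℓ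

  δ : Fin n → Fin n → ℕ
  δ u v = if does (u Fin.≟ v) then 0 else partDist (ℓ u) (ℓ v)

  δ-refl : ∀ u → δ u u ≡ 0
  δ-refl u = cong (λ b → if b then 0 else _) (dec-true (u Fin.≟ u) refl)

  δ-offDiag : ∀ {u v} → u ≢ v → δ u v ≡ partDist (ℓ u) (ℓ v)
  δ-offDiag {u} {v} u≢v = cong (λ b → if b then 0 else _) (dec-false (u Fin.≟ v) u≢v)

  edge⇒ : ∀ {u v} → T (G u v) → u ≢ v × T (partAdj (ℓ u) (ℓ v))
  edge⇒ {u} {v} Guv = let u≢v , adj = Equivalence.to T-∧ Guv in T-does⇒ (¬? (u Fin.≟ v)) u≢v , adj

  edge⇐ : ∀ {u v} → u ≢ v → T (partAdj (ℓ u) (ℓ v)) → T (G u v)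
  edge⇐ {u} {v} u≢v adj = Equivalence.from T-∧ (T-does⇐ (¬? (u Fin.≟ v)) u≢v , adj)

  differentParts : ∀ {u v} → ℓ u ≢ ℓ v → u ≢ v
  differentParts ℓu≢ℓv refl = ℓu≢ℓv refl

  δ≡0⇒≡ : ∀ {u v} → δ u v ≡ 0 → u ≡ v
  δ≡0⇒≡ {u} {v} δ≡0 with u Fin.≟ v
  ... | yes u≡v = u≡v
  ... | no  u≢v = contradiction (subst (1 ≤_) δ≡0 (partDist-positive (ℓ u) (ℓ v))) λ ()

  δ-edge : ∀ u {w v} → T (G w v) → δ u v ≤ suc (δ u w)
  δ-edge u {w} {v} Gwv with edge⇒ Gwv | u Fin.≟ v | u Fin.≟ w
  ... | _            | yes _ | _        = z≤n
  ... | _ , adj      | no _  | yes refl = ℕ.≤-reflexive (partAdj⇒partDist≡1 (ℓ u) (ℓ v) adj)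
  ... | _ , adj      | no _  | no _     = partDist-edge (ℓ u) (ℓ w) (ℓ v) adj

  δ-pred : ∀ u v {k} → δ u v ≡ suc k → ∃ λ w → T (G w v) × δ u w ≡ k
  δ-pred u v {k} δ≡1+k with u Fin.≟ v | k
  ... | no u≢v | zero   = u , edge⇐ u≢v (partDist≡1⇒partAdj (ℓ u) (ℓ v) δ≡1+k) , δ-refl u
  ... | no u≢v | suc k′ with partDist-pred (ℓ u) (ℓ v) (subst (2 ≤_) (sym δ≡1+k) (s≤s (s≤s z≤n)))
  ...   | r , r≢ℓu , r≢ℓv , adj , 1+dist≡ with onto r
  ...     | w , refl = w , edge⇐ (differentParts r≢ℓv) adj ,
                       trans (δ-offDiag (differentParts (r≢ℓu ∘ sym))) (ℕ.suc-injective (trans 1+dist≡ δ≡1+k))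

  δ≤n : ∀ u v → δ u v ≤ n
  δ≤n u v with u Fin.≟ v
  ... | yes _ = z≤n
  ... | no  _ = ℕ.≤-trans (partDist≤4 (ℓ u) (ℓ v)) (ℕ.≤-trans (ℕ.n≤1+n 4) (Onto⇒5≤n onto))

  open BreadthFirst G δ δ≡0⇒≡ δ-refl δ-edge δ-pred using (dist≡δ; connected)

  weight : Fin n → ℤ
  weight = partWeight ∘ ℓ

  DXat-blowUp : DXat G weight ≐ pullback (λ p q → + partDist p q) ℓ
  DXat-blowUp u v with u Fin.≟ v
  ... | yes refl = begin
    partWeight (ℓ u) + + dist G u u
      ≡⟨ cong (λ k → partWeight (ℓ u) + + k) (trans (dist≡δ u u (δ≤n u u)) (δ-refl u)) ⟩
    partWeight (ℓ u) + + 0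
      ≡⟨ partDist-diag (ℓ u) ⟨
    + partDist (ℓ u) (ℓ u) ∎
    where open ≡-Reasoning
  ... | no u≢v = begin
    + dist G u v
      ≡⟨ cong +_ (trans (dist≡δ u v (δ≤n u v)) (δ-offDiag u≢v)) ⟩
    + partDist (ℓ u) (ℓ v) ∎
    where open ≡-Reasoning

  minor≡0-mod2 : ∀ {k} (r c : IncMap (3 ℕ.+ k) n) → eval weight (minor G r c) ≡ + 0 mod + 2
  minor≡0-mod2 {k} r@(row , _) c@(col , _) =
    subst (_≡ + 0 mod + 2) (sym evaluated) (subst (detℤ D ≡_mod + 2) rank≤2 (detℤ-cong-mod parity))
    where
    D : Mat (3 ℕ.+ k)
    D a b = + partDist (ℓ (row a)) (ℓ (col b))
    evaluated : eval weight (minor G r c) ≡ detℤ D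
    evaluated = trans (eval-det weight (λ a b → DX G (row a) (col b)))
                      (detℤ-cong (λ a b → DXat-blowUp (row a) (col b)))
    R : Mat (3 ℕ.+ k)
    R a b = notB₁ (ℓ (row a)) * notB₁ (ℓ (col b)) + notB₂ (ℓ (row a)) * notB₂ (ℓ (col b))
    parity : ∀ a b → D a b ≡ R a b mod + 2
    parity a b = partDist-parity (ℓ (row a)) (ℓ (col b))
    rank≤2 : detℤ R ≡ + 0
    rank≤2 = rank≤2-det k (notB₁ ∘ ℓ ∘ row) (notB₂ ∘ ℓ ∘ row) (notB₁ ∘ ℓ ∘ col) (notB₂ ∘ ℓ ∘ col)

  ideal-even : ∀ {k} (ts : List (IncMap (3 ℕ.+ k) n × IncMap (3 ℕ.+ k) n × Poly n)) →
    + 2 ∣ eval weight (sumList (termsOf G ts))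
  ideal-even []                 = divides (+ 0) refl
  ideal-even ((r , c , h) ∷ ts) =
    ∣m∣n⇒∣m+n (∣n⇒∣m*n (eval weight h) (≡0-mod⇒∣ (minor≡0-mod2 r c))) (ideal-even ts)

  nontrivial : ∀ {i} → 3 ≤ i → ¬ TrivialIdeal G i
  nontrivial (s≤s (s≤s (s≤s _))) (ts , sum≈1) = 2∤1 (subst (+ 2 ∣_) (sum≈1 weight) (ideal-even ts))
    where
    2∤1 : ¬ (+ 2 ∣ + 1)
    2∤1 2∣1 = contradiction (ℕ.∣1⇒≡1 (∣⇒∣ᵤ 2∣1)) λ ()

  blowUp-Λ₂ : InLambda 2 G
  blowUp-Λ₂ = connected δ≤n , atMostTwoTrivial
    where
    atMostTwoTrivial : (is : List ℕ) → length is ≡ 3 → Unique is →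
      All (λ i → 1 ≤ i × i ≤ n) is → All (TrivialIdeal G) is → ⊥
    atMostTwoTrivial (a ∷ b ∷ c ∷ []) refl ((a≢b ∷ a≢c ∷ []) ∷ (b≢c ∷ []) ∷ [] ∷ [])
                     ((1≤a , _) ∷ (1≤b , _) ∷ (1≤c , _) ∷ []) (Ia ∷ Ib ∷ Ic ∷ [])
      with distinct-positive⇒≥3 a b c a≢b a≢c b≢c 1≤a 1≤b 1≤c
    ... | inj₁ 3≤a        = nontrivial 3≤a Ia
    ... | inj₂ (inj₁ 3≤b) = nontrivial 3≤b Ib
    ... | inj₂ (inj₂ 3≤c) = nontrivial 3≤c Ic

if-<ᵇ-yes : ∀ {A : Set} {m n} {x y : A} → m ℕ.< n → (if m <ᵇ n then x else y) ≡ x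
if-<ᵇ-yes m<n rewrite Equivalence.to T-≡ (ℕ.<⇒<ᵇ m<n) = refl

if-<ᵇ-no : ∀ {A : Set} {m n} {x y : A} → n ≤ m → (if m <ᵇ n then x else y) ≡ y
if-<ᵇ-no {m = m} {n} n≤m with m <ᵇ n in m<ᵇn
... | true  = contradiction n≤m (ℕ.<⇒≱ (ℕ.<ᵇ⇒< m n (subst T (sym m<ᵇn) _)))
... | false = refl

partOf-onto : ∀ m₁ n₁ m₂ n₂ m₃ → 1 ≤ m₁ → 1 ≤ n₁ → 1 ≤ m₂ → 1 ≤ n₂ → 1 ≤ m₃ →
  Onto (partOf m₁ n₁ m₂ n₂ m₃)
partOf-onto m₁ n₁ m₂ n₂ m₃ 0<m₁ 0<n₁ 0<m₂ 0<n₂ 0<m₃ = λ where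
    A₁ → vertexAt 0      0<N (if-<ᵇ-yes 0<m₁)
    B₁ → vertexAt m₁     s₁<N (trans (if-<ᵇ-no (ℕ.≤-refl {m₁})) (if-<ᵇ-yes s₁<s₂))
    A₂ → vertexAt s₂     s₂<N (trans (if-<ᵇ-no s₁≤s₂) (trans (if-<ᵇ-no (ℕ.≤-refl {s₂})) (if-<ᵇ-yes s₂<s₃)))
    B₂ → vertexAt s₃     s₃<N (trans (if-<ᵇ-no s₁≤s₃) (trans (if-<ᵇ-no s₂≤s₃)
                                (trans (if-<ᵇ-no (ℕ.≤-refl {s₃})) (if-<ᵇ-yes s₃<s₄))))
    A₃ → vertexAt s₄     s₄<N (trans (if-<ᵇ-no s₁≤s₄) (trans (if-<ᵇ-no s₂≤s₄)
                                (trans (if-<ᵇ-no s₃≤s₄) (if-<ᵇ-no (ℕ.≤-refl {s₄})))))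
  where
  N s₂ s₃ s₄ : ℕ
  s₂ = m₁ ℕ.+ n₁
  s₃ = s₂ ℕ.+ m₂
  s₄ = s₃ ℕ.+ n₂
  N  = PsiSize m₁ n₁ m₂ n₂ m₃

  partAt : ℕ → Part
  partAt t = if t <ᵇ m₁ then A₁ else if t <ᵇ s₂ then B₁ else if t <ᵇ s₃ then A₂ else if t <ᵇ s₄ then B₂ else A₃

  vertexAt : ∀ {p} t (t<N : t ℕ.< N) → partAt t ≡ p → ∃ λ u → partOf m₁ n₁ m₂ n₂ m₃ u ≡ p
  vertexAt t t<N partAt≡p = fromℕ< t<N , trans (cong partAt (toℕ-fromℕ< t<N)) partAt≡p

  s₁<s₂ : m₁ ℕ.< s₂
  s₁<s₂ = ℕ.m<m+n m₁ 0<n₁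
  s₂<s₃ : s₂ ℕ.< s₃
  s₂<s₃ = ℕ.m<m+n s₂ 0<m₂
  s₃<s₄ : s₃ ℕ.< s₄
  s₃<s₄ = ℕ.m<m+n s₃ 0<n₂
  s₄<N : s₄ ℕ.< N
  s₄<N = ℕ.m<m+n s₄ 0<m₃
  s₁≤s₂ : m₁ ≤ s₂
  s₁≤s₂ = ℕ.<⇒≤ s₁<s₂
  s₂≤s₃ : s₂ ≤ s₃
  s₂≤s₃ = ℕ.<⇒≤ s₂<s₃
  s₃≤s₄ : s₃ ≤ s₄
  s₃≤s₄ = ℕ.<⇒≤ s₃<s₄
  s₁≤s₃ : m₁ ≤ s₃
  s₁≤s₃ = ℕ.≤-trans s₁≤s₂ s₂≤s₃
  s₂≤s₄ : s₂ ≤ s₄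
  s₂≤s₄ = ℕ.≤-trans s₂≤s₃ s₃≤s₄
  s₁≤s₄ : m₁ ≤ s₄
  s₁≤s₄ = ℕ.≤-trans s₁≤s₃ s₃≤s₄
  s₃<N : s₃ ℕ.< N
  s₃<N = ℕ.<-trans s₃<s₄ s₄<N
  s₂<N : s₂ ℕ.< N
  s₂<N = ℕ.<-trans s₂<s₃ s₃<N
  s₁<N : m₁ ℕ.< N
  s₁<N = ℕ.<-trans s₁<s₂ s₂<N
  0<N : 0 ℕ.< N
  0<N = ℕ.<-≤-trans 0<m₁ (ℕ.<⇒≤ s₁<N)

mainTheorem11 : (m₁ n₁ m₂ n₂ m₃ : ℕ) → 1 ≤ m₁ → 1 ≤ n₁ → 1 ≤ m₂ → 1 ≤ n₂ → 1 ≤ m₃ →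
    SNFis1122 (DXat (Psi m₁ n₁ m₂ n₂ m₃) (dPsi m₁ n₁ m₂ n₂ m₃))
    × InLambda 2 (Psi m₁ n₁ m₂ n₂ m₃)
mainTheorem11 m₁ n₁ m₂ n₂ m₃ 1≤m₁ 1≤n₁ 1≤m₂ 1≤n₂ 1≤m₃ =
  EquivZ-respˡ DXat-blowUp (pullback-snf (λ p q → + partDist p q) partDist-snf ℓ onto) , blowUp-Λ₂
  where
  ℓ : Fin (PsiSize m₁ n₁ m₂ n₂ m₃) → Part
  ℓ = partOf m₁ n₁ m₂ n₂ m₃
  onto : Onto ℓ
  onto = partOf-onto m₁ n₁ m₂ n₂ m₃ 1≤m₁ 1≤n₁ 1≤m₂ 1≤n₂ 1≤m₃
  open BlowUp ℓ onto using (DXat-blowUp; blowUp-Λ₂)
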